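{- Let $(G,\boldsymbol{\gamma})$ be a $\mathbb{Z}$-colored graph. Then $(G,\boldsymbol{\gamma})$ is cone-Laman with $\mathbb{Z}$ colors if and only if, for some sufficiently large prime $p$, the $\mathbb{Z}/p\mathbb{Z}$-colored graph obtained by reducing all colors modulo $p$ is cone-Laman.
   Context: A $\Gamma$-colored graph ($\Gamma=\mathbb{Z}$ or $\mathbb{Z}/p\mathbb{Z}$) is a finite directed multigraph $G=(V,E)$ (self-loops and parallel edges allowed) with a color $\gamma_e\in\Gamma$ on each edge. For a cycle $C$, $\rho(C)\in\Gamma$ is the oriented sum of colors along $C$: add the colors of edges traversed forwards and subtract those traversed backwards. The $\rho$-rank of a subgraph is $0$ if all its cycles have $\rho(C)=0$, and $1$ otherwise. The colored graph is cone-Laman-sparse if every edge-induced subgraph with $n'$ vertices, $m'$ edges, $c'_0$ connected components of $\rho$-rank $0$ and $c'_1$ of $\rho$-rank $1$ satisfies $m'\le 2n'-3c'_0-c'_1$. It is cone-Laman if, moreover, equality holds for the whole graph. -}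

module Defs where

open import Data.Nat as ℕ using (ℕ; NonZero)
open import Data.Integer as ℤ using (ℤ; +_; 0ℤ)
open import Data.Integer.DivMod using (_%ℕ_; n%ℕd<d)
open import Data.Integer.Divisibility using () renaming (_∣_ to _∣ℤ_)
open import Data.Fin as Fin using (Fin; toℕ; fromℕ<)
open import Data.Fin.Subset using (Subset; _∈_; ⊤; ∣_∣)
open import Data.Bool using (Bool; true; false)
open import Data.List using (List; []; _∷_; map; length)
open import Data.List.Relation.Unary.Unique.Propositional using (Unique)
import Data.List.Membership.Propositional as LMem
open import Data.Product using (Σ; ∃; _×_; _,_; proj₁)
open import Data.Sum using (_⊎_)
open import Data.Empty using (⊥)
open import Data.Unit using () renaming (⊤ to Unit)
open import Relation.Binary.PropositionalEquality using (_≡_)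
open import Relation.Nullary using (¬_)

record CGraph (C : Set) : Set where
  field
    n   : ℕ
    m   : ℕ
    src : Fin m → Fin n
    tgt : Fin m → Fin n
    col : Fin m → C

Count : {k : ℕ} → (Fin k → Set) → ℕ → Set
Count {k} P c = Σ (List (Fin k)) λ xs →
  (length xs ≡ c) × Unique xs × (∀ x → (x LMem.∈ xs → P x) × (P x → x LMem.∈ xs))

-- The group Γ is represented through a map
-- w : C → ℤ of colors to integer representatives (a group homomorphism
-- ℤ → Γ composed with a section) and a predicate IsZero on ℤ telling when
-- an integer represents 0 in Γ.  For Γ = ℤ: w = id, IsZero x = (x ≡ 0).
-- For Γ = ℤ/pℤ with colors in Fin p: w a = toℕ a, IsZero x = (p ∣ x).
module Sparsity {C : Set} (w : C → ℤ) (IsZero : ℤ → Set) (G : CGraph C) where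
  open CGraph G

  Step : Set
  Step = Fin m × Bool

  start : Step → Fin n
  start (e , true)  = src e
  start (e , false) = tgt e

  end : Step → Fin n
  end (e , true)  = tgt e
  end (e , false) = src e

  WalkFrom : Fin n → List Step → Fin n → Set
  WalkFrom u []       v = u ≡ v
  WalkFrom u (s ∷ ss) v = (start s ≡ u) × WalkFrom (end s) ss v

  ρ : List Step → ℤ
  ρ []                   = 0ℤ
  ρ ((e , true)  ∷ ss) = w (col e) ℤ.+ ρ ss
  ρ ((e , false) ∷ ss) = ℤ.- w (col e) ℤ.+ ρ ss

  IsCycle : Subset m → List Step → Set
  IsCycle S []       = ⊥
  IsCycle S (s ∷ ss) =
    WalkFrom (start s) (s ∷ ss) (start s)
    × (∀ t → t LMem.∈ (s ∷ ss) → proj₁ t ∈ S)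
    × Unique (map proj₁ (s ∷ ss))
    × Unique (map start (s ∷ ss))

  data Conn (S : Subset m) : Fin n → Fin n → Set where
    conn-refl : ∀ {u} → Conn S u u
    conn-fwd  : ∀ {u} e → e ∈ S → Conn S u (src e) → Conn S u (tgt e)
    conn-bwd  : ∀ {u} e → e ∈ S → Conn S u (tgt e) → Conn S u (src e)

  InV : Subset m → Fin n → Set
  InV S v = ∃ λ e → e ∈ S × (src e ≡ v ⊎ tgt e ≡ v)

  -- the connected component (within subgraph with vertex set V, edges S)
  -- containing v has ρ-rank 0: every cycle of S meeting it has ρ = 0
  Rank0 : Subset m → Fin n → Set
  Rank0 S v = ∀ cs → IsCycle S cs → (∀ t → t LMem.∈ cs → Conn S v (start t)) → IsZero (ρ cs)

  -- v is the (Fin-)least vertex of its component: component representative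
  Rep : (Fin n → Set) → Subset m → Fin n → Set
  Rep V S v = V v × (∀ u → Conn S u v → v Fin.≤ u)

  Rep0 Rep1 : (Fin n → Set) → Subset m → Fin n → Set
  Rep0 V S v = Rep V S v × Rank0 S v
  Rep1 V S v = Rep V S v × ¬ Rank0 S v

  ConeLamanSparse : Set
  ConeLamanSparse = ∀ (S : Subset m) (n' c₀ c₁ : ℕ) →
    Count (InV S) n' → Count (Rep0 (InV S) S) c₀ → Count (Rep1 (InV S) S) c₁ →
    ∣ S ∣ ℕ.+ 3 ℕ.* c₀ ℕ.+ c₁ ℕ.≤ 2 ℕ.* n'

  ConeLaman : Set
  ConeLaman = ConeLamanSparse × (∀ (c₀ c₁ : ℕ) →
    Count (Rep0 (λ _ → Unit) ⊤) c₀ → Count (Rep1 (λ _ → Unit) ⊤) c₁ →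
    m ℕ.+ 3 ℕ.* c₀ ℕ.+ c₁ ≡ 2 ℕ.* n)

ConeLamanℤ : CGraph ℤ → Set
ConeLamanℤ G = Sparsity.ConeLaman (λ x → x) (λ x → x ≡ 0ℤ) G

ConeLamanMod : (p : ℕ) → CGraph (Fin p) → Set
ConeLamanMod p G = Sparsity.ConeLaman (λ a → + toℕ a) (λ x → (+ p) ∣ℤ x) G

reduce : (p : ℕ) .{{_ : NonZero p}} → CGraph ℤ → CGraph (Fin p)
reduce p G = record
  { n = n ; m = m ; src = src ; tgt = tgt
  ; col = λ e → fromℕ< (n%ℕd<d (col e) p) }
  where open CGraph G

-- The sparsity counts depend on the colours only through the set of balanced
-- cycles (ρ = 0), so it suffices that reducing the colours modulo p does not change
-- which cycles are balanced.  A cycle uses at most m distinct edges, so its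
-- integer ρ has absolute value at most m · Σₑ |γₑ|, while its reduced ρ is
-- congruent to it modulo p; once p exceeds that bound, ρ ≡ 0 (mod p) forces ρ = 0.
module Submission where

open import Defs
open import Data.Nat using (ℕ; NonZero; _≤_)
open import Data.Nat.Primality using (Prime)
open import Data.Integer using (ℤ)
open import Data.Product using (∃-syntax)
open import Function.Bundles using (_⇔_)

open import Data.Nat as ℕ using (zero; suc; _<_)
import Data.Nat.Properties as ℕ
open import Data.Nat.DivMod using (m<n⇒m%n≡m)
open import Data.Nat.Divisibility using (n∣m⇒m%n≡0)
open import Data.Integer as ℤ using (+_; 0ℤ; -_; _-_; ∣_∣)
import Data.Integer.Properties as ℤ
open import Data.Integer.DivMod using (_%ℕ_; _/ℕ_; n%ℕd<d; a≡a%ℕn+[a/ℕn]*n)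
open import Data.Integer.Divisibility.Signed
  using (_∣_; divides; ∣ᵤ⇒∣; ∣⇒∣ᵤ; ∣m∣n⇒∣m+n; ∣m∣n⇒∣m-n; ∣m⇒∣-m)
open import Data.Integer.Divisibility using () renaming (_∣_ to _∣ᵤ_)
open import Data.Integer.Tactic.RingSolver using (solve-∀)
open import Data.Fin as Fin using (Fin; toℕ; fromℕ<)
open import Data.Fin.Properties using (toℕ-fromℕ<; injective⇒≤)
open import Data.Fin.Subset using (⊤)
open import Data.Bool using (true; false)
open import Data.List using (List; []; _∷_; length; lookup)
open import Data.List.Properties using (length-map; map-cong)
open import Data.List.Relation.Unary.Unique.Propositional using (Unique)
open import Data.List.Relation.Unary.AllPairs using (_∷_)
import Data.List.Relation.Unary.All as All
open import Data.List.Membership.Propositional.Properties using (∈-lookup)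
open import Data.Product using (_,_; proj₁; proj₂)
open import Data.Empty using (⊥-elim)
open import Function using (_∘_; Injective)
open import Function.Bundles using (mk⇔; Equivalence)
open import Function.Construct.Composition using (_⇔-∘_)
open import Function.Construct.Symmetry using (⇔-sym)
open import Function.Related.TypeIsomorphisms using (¬-cong-⇔)
open import Data.Product.Function.NonDependent.Propositional using (_×-⇔_)
open import Relation.Binary.PropositionalEquality
  using (_≡_; refl; sym; trans; cong; subst; module ≡-Reasoning)

open Equivalence using (to; from)

Count-⇔ : ∀ {k c} {P Q : Fin k → Set} → (∀ x → P x ⇔ Q x) → Count P c → Count Q c
Count-⇔ P⇔Q (xs , len , uniq , complete) =
  xs , len , uniq , λ x → to (P⇔Q x) ∘ proj₁ (complete x) , proj₂ (complete x) ∘ from (P⇔Q x)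

Unique⇒lookup-injective : ∀ {A : Set} {xs : List A} → Unique xs → Injective _≡_ _≡_ (lookup xs)
Unique⇒lookup-injective {xs = _ ∷ _} _ {Fin.zero} {Fin.zero} _ = refl
Unique⇒lookup-injective {xs = _ ∷ _} (x∉ ∷ _) {Fin.zero} {Fin.suc j} eq =
  ⊥-elim (All.lookup x∉ (∈-lookup j) eq)
Unique⇒lookup-injective {xs = _ ∷ _} (x∉ ∷ _) {Fin.suc i} {Fin.zero} eq =
  ⊥-elim (All.lookup x∉ (∈-lookup i) (sym eq))
Unique⇒lookup-injective {xs = _ ∷ _} (_ ∷ uniq) {Fin.suc i} {Fin.suc j} eq =
  cong Fin.suc (Unique⇒lookup-injective uniq eq)

Unique⇒length≤ : ∀ {m} {xs : List (Fin m)} → Unique xs → length xs ≤ m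
Unique⇒length≤ uniq = injective⇒≤ (Unique⇒lookup-injective uniq)

∑∣_∣ : ∀ {k} → (Fin k → ℤ) → ℕ
∑∣_∣ {zero}  f = 0
∑∣_∣ {suc k} f = ∣ f Fin.zero ∣ ℕ.+ ∑∣ f ∘ Fin.suc ∣

∣f∣≤∑∣f∣ : ∀ {k} (f : Fin k → ℤ) i → ∣ f i ∣ ≤ ∑∣ f ∣
∣f∣≤∑∣f∣ f Fin.zero    = ℕ.m≤m+n _ _
∣f∣≤∑∣f∣ f (Fin.suc i) = ℕ.≤-trans (∣f∣≤∑∣f∣ (f ∘ Fin.suc) i) (ℕ.m≤n+m _ _)

∣i∣<n⇒[i≡0⇔n∣i] : ∀ {n i} .{{_ : NonZero n}} → ∣ i ∣ < n → (i ≡ 0ℤ) ⇔ (+ n ∣ i)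
∣i∣<n⇒[i≡0⇔n∣i] {n} {i} ∣i∣<n = mk⇔
  (λ { refl → divides 0ℤ refl })
  (λ n∣i → ℤ.∣i∣≡0⇒i≡0 (trans (sym (m<n⇒m%n≡m ∣i∣<n)) (n∣m⇒m%n≡0 ∣ i ∣ n (∣⇒∣ᵤ n∣i))))

∣-cong-mod : ∀ {k i j} → k ∣ i - j → (k ∣ i) ⇔ (k ∣ j)
∣-cong-mod {k} {i} {j} k∣i-j = mk⇔
  (λ k∣i → subst (k ∣_) (i-[i-j]≡j i j) (∣m∣n⇒∣m-n k∣i k∣i-j))
  (λ k∣j → subst (k ∣_) ([i-j]+j≡i i j) (∣m∣n⇒∣m+n k∣i-j k∣j))
  where
  i-[i-j]≡j : ∀ i j → i - (i - j) ≡ j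
  i-[i-j]≡j = solve-∀
  [i-j]+j≡i : ∀ i j → (i - j) ℤ.+ j ≡ i
  [i-j]+j≡i = solve-∀

module CycleBounds {C : Set} (w : C → ℤ) (IsZero : ℤ → Set) (G : CGraph C) where
  open CGraph G
  open Sparsity w IsZero G

  IsCycle⇒length≤m : ∀ {S} cs → IsCycle S cs → length cs ≤ m
  IsCycle⇒length≤m cs@(_ ∷ _) (_ , _ , distinct-edges , _) =
    subst (_≤ m) (length-map proj₁ cs) (Unique⇒length≤ distinct-edges)

  ∣ρ∣≤length*∑∣col∣ : ∀ cs → ∣ ρ cs ∣ ≤ length cs ℕ.* ∑∣ w ∘ col ∣
  ∣ρ∣≤length*∑∣col∣ [] = ℕ.z≤n
  ∣ρ∣≤length*∑∣col∣ ((e , true) ∷ ss) =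
    ℕ.≤-trans (ℤ.∣i+j∣≤∣i∣+∣j∣ (w (col e)) (ρ ss))
      (ℕ.+-mono-≤ (∣f∣≤∑∣f∣ (w ∘ col) e) (∣ρ∣≤length*∑∣col∣ ss))
  ∣ρ∣≤length*∑∣col∣ ((e , false) ∷ ss) =
    ℕ.≤-trans (ℤ.∣i+j∣≤∣i∣+∣j∣ (- w (col e)) (ρ ss))
      (ℕ.+-mono-≤ (subst (_≤ _) (sym (ℤ.∣-i∣≡∣i∣ (w (col e)))) (∣f∣≤∑∣f∣ (w ∘ col) e))
        (∣ρ∣≤length*∑∣col∣ ss))

recolour : ∀ {C D} (G : CGraph C) → (Fin (CGraph.m G) → D) → CGraph D
recolour G col′ = record { n = n ; m = m ; src = src ; tgt = tgt ; col = col′ }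
  where open CGraph G

module SameShape {C D : Set} (v : C → ℤ) (IsZeroC : ℤ → Set) (w : D → ℤ) (IsZeroD : ℤ → Set)
                 (G : CGraph C) (col′ : Fin (CGraph.m G) → D) where
  module A = Sparsity v IsZeroC G
  module B = Sparsity w IsZeroD (recolour G col′)

  start-recolour : ∀ s → A.start s ≡ B.start s
  start-recolour (_ , true)  = refl
  start-recolour (_ , false) = refl

  walk-recolour : ∀ {u v} ss → A.WalkFrom u ss v → B.WalkFrom u ss v
  walk-recolour []                 walk         = walk
  walk-recolour ((_ , true)  ∷ ss) (ok , walk) = ok , walk-recolour ss walk
  walk-recolour ((_ , false) ∷ ss) (ok , walk) = ok , walk-recolour ss walk

  cycle-recolour : ∀ {S} cs → A.IsCycle S cs → B.IsCycle S cs
  cycle-recolour cs@(s ∷ _) (closed , inS , distinct-edges , distinct-vertices) =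
    subst (λ u → B.WalkFrom u cs u) (start-recolour s) (walk-recolour cs closed) ,
    inS , distinct-edges , subst Unique (map-cong start-recolour cs) distinct-vertices

  conn-recolour : ∀ {S u v} → A.Conn S u v → B.Conn S u v
  conn-recolour A.conn-refl            = B.conn-refl
  conn-recolour (A.conn-fwd e e∈S c) = B.conn-fwd e e∈S (conn-recolour c)
  conn-recolour (A.conn-bwd e e∈S c) = B.conn-bwd e e∈S (conn-recolour c)

module Recolouring {C D : Set} (v : C → ℤ) (IsZeroC : ℤ → Set) (w : D → ℤ) (IsZeroD : ℤ → Set)
                   (G : CGraph C) (col′ : Fin (CGraph.m G) → D) where
  open CGraph G
  open SameShape v IsZeroC w IsZeroD G col′ public
  -- Recolouring back with col gives G again (up to η), so Back transports from B to A.
  module Back = SameShape w IsZeroD v IsZeroC (recolour G col′) col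

  ρ-congruent : ∀ {k} → (∀ e → k ∣ v (col e) - w (col′ e)) → ∀ cs → k ∣ A.ρ cs - B.ρ cs
  ρ-congruent k∣edge []                 = divides 0ℤ refl
  ρ-congruent k∣edge ((e , true) ∷ ss)  =
    subst (_ ∣_) (sym ([a+b]-[c+d]≡[a-c]+[b-d] (v (col e)) (A.ρ ss) (w (col′ e)) (B.ρ ss)))
      (∣m∣n⇒∣m+n (k∣edge e) (ρ-congruent k∣edge ss))
    where
    [a+b]-[c+d]≡[a-c]+[b-d] : ∀ a b c d → (a ℤ.+ b) - (c ℤ.+ d) ≡ (a - c) ℤ.+ (b - d)
    [a+b]-[c+d]≡[a-c]+[b-d] = solve-∀
  ρ-congruent k∣edge ((e , false) ∷ ss) =
    subst (_ ∣_) (sym ([-a+b]-[-c+d]≡-[a-c]+[b-d] (v (col e)) (A.ρ ss) (w (col′ e)) (B.ρ ss)))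
      (∣m∣n⇒∣m+n (∣m⇒∣-m (k∣edge e)) (ρ-congruent k∣edge ss))
    where
    [-a+b]-[-c+d]≡-[a-c]+[b-d] : ∀ a b c d → (- a ℤ.+ b) - (- c ℤ.+ d) ≡ - (a - c) ℤ.+ (b - d)
    [-a+b]-[-c+d]≡-[a-c]+[b-d] = solve-∀

  module _ (balanced-⇔ : ∀ S cs → A.IsCycle S cs → IsZeroC (A.ρ cs) ⇔ IsZeroD (B.ρ cs)) where

    Rank0-⇔ : ∀ S u → A.Rank0 S u ⇔ B.Rank0 S u
    Rank0-⇔ S u = mk⇔
      (λ rank0 cs cyc meets → let cycA = Back.cycle-recolour cs cyc in
        to (balanced-⇔ S cs cycA) (rank0 cs cycA λ t t∈cs →
          subst (A.Conn S u) (Back.start-recolour t) (Back.conn-recolour (meets t t∈cs))))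
      (λ rank0 cs cyc meets →
        from (balanced-⇔ S cs cyc) (rank0 cs (cycle-recolour cs cyc) λ t t∈cs →
          subst (B.Conn S u) (start-recolour t) (conn-recolour (meets t t∈cs))))

    Rep-⇔ : ∀ V S u → A.Rep V S u ⇔ B.Rep V S u
    Rep-⇔ V S u = mk⇔
      (λ (u∈V , least) → u∈V , λ u′ c → least u′ (Back.conn-recolour c))
      (λ (u∈V , least) → u∈V , λ u′ c → least u′ (conn-recolour c))

    Rep0-⇔ : ∀ V S u → A.Rep0 V S u ⇔ B.Rep0 V S u
    Rep0-⇔ V S u = Rep-⇔ V S u ×-⇔ Rank0-⇔ S u

    Rep1-⇔ : ∀ V S u → A.Rep1 V S u ⇔ B.Rep1 V S u
    Rep1-⇔ V S u = Rep-⇔ V S u ×-⇔ ¬-cong-⇔ (Rank0-⇔ S u)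

    ConeLaman-⇔ : A.ConeLaman ⇔ B.ConeLaman
    ConeLaman-⇔ = mk⇔
      (λ (sparse , tight) →
        (λ S n′ c₀ c₁ vs r0 r1 → sparse S n′ c₀ c₁ vs (Count-⇔ (⇔-sym ∘ Rep0-⇔ _ S) r0)
                                                       (Count-⇔ (⇔-sym ∘ Rep1-⇔ _ S) r1)) ,
        (λ c₀ c₁ r0 r1 → tight c₀ c₁ (Count-⇔ (⇔-sym ∘ Rep0-⇔ _ ⊤) r0)
                                     (Count-⇔ (⇔-sym ∘ Rep1-⇔ _ ⊤) r1)))
      (λ (sparse , tight) →
        (λ S n′ c₀ c₁ vs r0 r1 → sparse S n′ c₀ c₁ vs (Count-⇔ (Rep0-⇔ _ S) r0)
                                                       (Count-⇔ (Rep1-⇔ _ S) r1)) ,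
        (λ c₀ c₁ r0 r1 → tight c₀ c₁ (Count-⇔ (Rep0-⇔ _ ⊤) r0) (Count-⇔ (Rep1-⇔ _ ⊤) r1)))

module Reduction (G : CGraph ℤ) (p : ℕ) .{{_ : NonZero p}} where
  open CGraph G
  open CycleBounds (λ x → x) (λ x → x ≡ 0ℤ) G
  open Recolouring (λ x → x) (λ x → x ≡ 0ℤ) (λ a → + toℕ a) (λ x → + p ∣ᵤ x)
                   G (CGraph.col (reduce p G)) public

  col-reduce-congruent : ∀ e → + p ∣ col e - + toℕ (CGraph.col (reduce p G) e)
  col-reduce-congruent e = divides (col e /ℕ p) (begin
    col e - + toℕ (fromℕ< (n%ℕd<d (col e) p))    ≡⟨ cong (λ r → col e - + r) (toℕ-fromℕ< _) ⟩
    col e - + r                                    ≡⟨ cong (_- + r) (a≡a%ℕn+[a/ℕn]*n (col e) p) ⟩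
    (+ r ℤ.+ (col e /ℕ p) ℤ.* + p) - + r          ≡⟨ [r+x]-r≡x (+ r) _ ⟩
    (col e /ℕ p) ℤ.* + p                           ∎)
    where
    open ≡-Reasoning
    r : ℕ
    r = col e %ℕ p
    [r+x]-r≡x : ∀ r x → (r ℤ.+ x) - r ≡ x
    [r+x]-r≡x = solve-∀

  balanced-⇔ : suc (m ℕ.* ∑∣ col ∣) ≤ p →
               ∀ S cs → A.IsCycle S cs → (A.ρ cs ≡ 0ℤ) ⇔ (+ p ∣ᵤ B.ρ cs)
  balanced-⇔ large S cs cycle =
    mk⇔ ∣⇒∣ᵤ ∣ᵤ⇒∣ ⇔-∘ (∣-cong-mod (ρ-congruent col-reduce-congruent cs) ⇔-∘ ∣i∣<n⇒[i≡0⇔n∣i] ∣ρ∣<p)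
    where
    ∣ρ∣<p : ∣ A.ρ cs ∣ < p
    ∣ρ∣<p = ℕ.<-≤-trans
      (ℕ.s≤s (ℕ.≤-trans (∣ρ∣≤length*∑∣col∣ cs) (ℕ.*-monoˡ-≤ _ (IsCycle⇒length≤m cs cycle)))) large

lemma16 : (G : CGraph ℤ) →
    ∃[ N ] (∀ (p : ℕ) .{{_ : NonZero p}} → Prime p → N ≤ p →
      (ConeLamanℤ G ⇔ ConeLamanMod p (reduce p G)))
lemma16 G = suc (m ℕ.* ∑∣ col ∣) , λ p _ large → ConeLaman-⇔ G p (balanced-⇔ G p large)
  where
  open CGraph G
  open Reduction using (ConeLaman-⇔; balanced-⇔)
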